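{- Let $\sigma$ be a bicolored subdivision of type $(k,n)$. Suppose $w\in D_n$ and the total cyclic order $C_w$ is a circular extension of $C_\sigma$. Then $w\in D_{k+1,n}$.
   Context: Let $\mathbf P_n$ be a convex $n$-gon with vertices labeled $1,\dots,n$ clockwise. A bicolored subdivision $\sigma$ of $\mathbf P_n$ is a partition into polygons (vertices among those of $\mathbf P_n$) colored black or white, polygons sharing an edge having different colors; type $(k,n)$ means any triangulation of the black polygons has exactly $k$ triangles. A (partial) cyclic order on a finite set $X$ is a relation $C\subseteq X^3$ that is cyclic ($(a,b,c)\in C\Rightarrow (c,a,b)\in C$), asymmetric ($(a,b,c)\in C\Rightarrow (c,b,a)\notin C$) and transitive ($(a,b,c),(a,c,d)\in C\Rightarrow (a,b,d)\in C$); it is total if for all distinct $a,b,c$ either $(a,b,c)$ or $(a,c,b)$ is in $C$. A circular extension of $C$ is a total cyclic order containing $C$. For distinct $x_1,\dots,x_m$ the chain $C_{(x_1,\dots,x_m)}$ consists of all $(x_i,x_j,x_\ell)$, $i<j<\ell$, together with their cyclic rotations. $C_\sigma$ is the union over all polygons of $\sigma$ of the chains $C_{(v_1,\dots,v_r)}$ where $v_1,\dots,v_r$ are the polygon's vertices in clockwise order if white and counterclockwise order if black. For $w=w_1\cdots w_n\in S_n$, $C_w$ is the total cyclic order $C_{(w_1,\dots,w_n)}$. For $w\in S_n$, $i\in[n]$ is a cyclic descent of $w$ if either $i<n$ and $i$ occurs to the right of $i+1$ in $w$, or $i=n$ and $1$ occurs to the left of $n$ in $w$. $D_n=\{w\in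 S_n: w_n=n\}$, and $D_{k+1,n}$ is the set of $w\in D_n$ with exactly $k+1$ cyclic descents. -}

module Defs where

open import Data.Nat as ℕ using (ℕ; zero; suc; _∸_)
open import Data.Bool using (Bool; true; false; if_then_else_)
open import Data.Fin as Fin using (Fin; toℕ)
open import Data.Fin.Permutation using (Permutation′; _⟨$⟩ʳ_; _⟨$⟩ˡ_)
open import Data.Fin.Subset as Sub using (Subset)
open import Data.List using (List; []; _∷_; length; map; reverse; tabulate)
open import Data.Nat.ListAction using (sum)
open import Data.List.Membership.Propositional using (_∈_)
open import Data.List.Relation.Unary.Linked using (Linked)
open import Data.List.Relation.Unary.AllPairs using (AllPairs)
open import Data.List.Relation.Binary.Sublist.Propositional using (_⊆_)
open import Data.Product using (Σ; _×_; ∃; ∃-syntax)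
open import Data.Sum using (_⊎_)
open import Relation.Nullary using (¬_)
open import Relation.Binary.PropositionalEquality using (_≡_; _≢_)

-- Vertices of P_n: label j ∈ {1..n} is represented by i : Fin n with toℕ i = j - 1.
-- Labels increase clockwise, so a strictly increasing list of vertices lists a
-- polygon's vertices in clockwise order.

-- A colored cell of a subdivision: a polygon with vertices among those of P_n,
-- listed clockwise (strictly increasing), with at least 3 vertices, and a color
-- (black = true, white = false).
record Cell (n : ℕ) : Set where
  field
    verts      : List (Fin n)
    increasing : Linked Fin._<_ verts
    atLeast3   : 3 ℕ.≤ length verts
    black      : Bool
open Cell public

-- {x,y} (x < y) is an edge of the polygon: x,y consecutive in the clockwise
-- cyclic order of its vertices.
IsEdge : ∀ {n} → Cell n → Fin n → Fin n → Set
IsEdge c x y = x ∈ verts c × y ∈ verts c × x Fin.< y ×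
  ((∀ z → z ∈ verts c → ¬ (x Fin.< z × z Fin.< y))
   ⊎ (∀ z → z ∈ verts c → (x Fin.≤ z × z Fin.≤ y)))

ShareEdge : ∀ {n} → Cell n → Cell n → Set
ShareEdge c d = ∃[ x ] ∃[ y ] (IsEdge c x y × IsEdge d x y)

Crosses : ∀ {n} → Cell n → Cell n → Set
Crosses c d = ∃[ a ] ∃[ b ] ∃[ a′ ] ∃[ b′ ]
  (a ∈ verts c × b ∈ verts d × a′ ∈ verts c × b′ ∈ verts d ×
   a Fin.< b × b Fin.< a′ × a′ Fin.< b′)

Share3 : ∀ {n} → Cell n → Cell n → Set
Share3 c d = ∃[ x ] ∃[ y ] ∃[ z ]
  (x ∈ verts c × y ∈ verts c × z ∈ verts c ×
   x ∈ verts d × y ∈ verts d × z ∈ verts d × x Fin.< y × y Fin.< z)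

-- Two convex polygons with vertices in convex position have disjoint interiors
-- iff no chords cross and they share at most two vertices.
InteriorDisjoint : ∀ {n} → Cell n → Cell n → Set
InteriorDisjoint c d = ¬ Crosses c d × ¬ Crosses d c × ¬ Share3 c d

-- Number of triangles in any triangulation of the polygon.
triangles : ∀ {n} → Cell n → ℕ
triangles c = length (verts c) ∸ 2

blackTriangles : ∀ {n} → Cell n → ℕ
blackTriangles c = if black c then triangles c else 0

-- A bicolored subdivision of P_n: a list of colored polygons with pairwise
-- disjoint interiors, covering P_n (total triangle count n-2), such that
-- polygons sharing an edge have different colors.
record BicoloredSubdivision (n : ℕ) : Set where
  field
    cells    : List (Cell n)
    disjoint : AllPairs (λ c d → InteriorDisjoint c d × (ShareEdge c d → black c ≢ black d)) cells
    covers   : sum (map triangles cells) ≡ n ∸ 2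
open BicoloredSubdivision public

HasType : ∀ {n} → BicoloredSubdivision n → ℕ → Set
HasType σ k = sum (map blackTriangles (cells σ)) ≡ k

TernRel : ℕ → Set₁
TernRel n = Fin n → Fin n → Fin n → Set

Chain : ∀ {n} → List (Fin n) → TernRel n
Chain xs a b c = (a ∷ b ∷ c ∷ []) ⊆ xs ⊎ (b ∷ c ∷ a ∷ []) ⊆ xs ⊎ (c ∷ a ∷ b ∷ []) ⊆ xs

oriented : ∀ {n} → Cell n → List (Fin n)
oriented c = if black c then reverse (verts c) else verts c

Cσ : ∀ {n} → BicoloredSubdivision n → TernRel n
Cσ σ a b c = ∃[ P ] (P ∈ cells σ × Chain (oriented P) a b c)

-- w ∈ S_n as a permutation: w_i = w ⟨$⟩ʳ i (positions and values 0-indexed).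
Cw : ∀ {n} → Permutation′ n → TernRel n
Cw w = Chain (tabulate (w ⟨$⟩ʳ_))

_⊆³_ : ∀ {n} → TernRel n → TernRel n → Set
C ⊆³ D = ∀ a b c → C a b c → D a b c

pos : ∀ {n} → Permutation′ n → Fin n → Fin n
pos w v = w ⟨$⟩ˡ v

-- cyclic descent (i is the vertex with label toℕ i + 1)
IsCycDescent : ∀ {n} → Permutation′ n → Fin n → Set
IsCycDescent {n} w i =
  (Σ (Fin n) λ j → toℕ j ≡ suc (toℕ i) × pos w j Fin.< pos w i)
  ⊎ (suc (toℕ i) ≡ n × Σ (Fin n) λ z → toℕ z ≡ 0 × pos w z Fin.< pos w i)

InD : ∀ {n} → Permutation′ n → Set
InD {n} w = ∀ i → suc (toℕ i) ≡ n → suc (toℕ (w ⟨$⟩ʳ i)) ≡ n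

InDk : ∀ {n} → ℕ → Permutation′ n → Set
InDk {n} m w = InD w × Σ (Subset n) λ S →
  Sub.∣ S ∣ ≡ m × (∀ i → (i Sub.∈ S → IsCycDescent w i) × (IsCycDescent w i → i Sub.∈ S))

module Submission where

-- Rank each vertex by its position in w and count the descents of a cyclic list of vertices
-- (steps to a vertex of smaller rank).  Since C_w extends C_σ, w visits the vertices of a white
-- cell in clockwise order, so the cell has exactly one cyclic descent, and those of a black
-- cell with r vertices in counterclockwise order, giving r − 1 = (its triangle count) + 1.
-- Cutting a polygon along a chord ab splits its count into the counts of the two halves minus
-- one, since exactly one of the steps a → b, b → a is a descent.  By induction on the number
-- of vertices (a cell either is the whole polygon or has a chord with every other cell on one
-- side of it), the counts of the cells of a subdivision add up to (count of the n-gon) +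
-- (number of cells) − 1.  So the n-gon 1, 2, …, n has k + 1 cyclic descents, and these are
-- exactly the cyclic descents of w.

open import Defs
open import Data.Bool using (Bool; true; false; if_then_else_)
open import Data.Bool.Properties using () renaming (_≟_ to _≟ᵇ_)
open import Data.Empty using (⊥-elim)
open import Data.Fin as Fin using (Fin; zero; suc; toℕ)
open import Data.Fin.Permutation using (Permutation′; _⟨$⟩ʳ_; inverseˡ; inverseʳ)
import Data.Fin.Properties as Finₚ
open import Data.Fin.Properties using (toℕ-injective; toℕ<n)
open import Data.Fin.Subset as Sub using (Subset)
open import Data.List
  using (List; []; _∷_; _++_; [_]; take; length; map; filter; tabulate; allFin; reverse; initLast; _∷ʳ′_)
import Data.List.Membership.DecPropositional as DecMembership
open import Data.List.Membership.Propositional using (_∈_; find; lose)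
open import Data.List.Membership.Propositional.Properties
  using (∈-++⁻; ∈-++⁺ˡ; ∈-++⁺ʳ; ∈-∃++; ∈-filter⁻; ∈-allFin)
open import Data.List.Properties using (++-assoc; length-++; length-tabulate)
open import Data.List.Relation.Binary.Sublist.Propositional using (_⊆_; []; _∷_; _∷ʳ_; ⊆-refl; from∈)
open import Data.List.Relation.Binary.Sublist.Propositional.Properties
  using ([]⊆-universal; ++⁺; ++⁺ˡ; All-resp-⊆; length-mono-≤; reverse⁺)
open import Data.List.Relation.Unary.All using (All; []; _∷_; lookup)
open import Data.List.Relation.Unary.AllPairs as AllPairs using (AllPairs; []; _∷_)
open import Data.List.Relation.Unary.AllPairs.Properties using (filter⁺; tabulate⁺-<)
open import Data.List.Relation.Unary.Any using (Any; here; there; any?)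
open import Data.List.Relation.Unary.Linked using (Linked; []; [-]; _∷_)
open import Data.List.Relation.Unary.Linked.Properties using (Linked⇒AllPairs)
open import Data.Nat as ℕ using (ℕ; zero; suc; _+_; _*_; _∸_; _≤_; _<_; s≤s)
open import Data.Nat.Induction using (<-wellFounded)
open import Data.Nat.ListAction using (sum)
open import Data.Nat.Properties
  using ( <-cmp; <-asym; <-irrefl; <-trans; <⇒≤; <⇒≱; ≮⇒≥; ≤-refl; ≤-reflexive; ≤-trans; ≤-antisym
        ; n≤1+n; m∸n+n≡m; +-comm; +-assoc; +-suc; +-identityʳ; *-identityʳ; *-zeroʳ
        ; +-mono-≤; +-monoʳ-≤; +-mono-<-≤; +-cancelˡ-≡; +-cancelʳ-≡; +-cancelʳ-≤; +-commutativeSemigroup )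
open import Data.Nat.Tactic.RingSolver using (solve-∀)
open import Algebra.Properties.CommutativeSemigroup +-commutativeSemigroup
  using (interchange; x∙yz≈y∙xz; x∙yz≈yx∙z; x∙yz≈xz∙y; xy∙z≈xz∙y)
open import Data.Product using (_×_; _,_; ∃; ∃₂; proj₁; proj₂)
open import Data.Sum using (_⊎_; inj₁; inj₂)
import Data.Vec as Vec
open import Data.Vec.Properties using (lookup∘tabulate; lookup⇒[]=; []=⇒lookup)
open import Function using (_∘_; id)
open import Induction.WellFounded using (module All)
open import Level using (0ℓ)
open import Relation.Binary.Construct.On as On using ()
open import Relation.Binary.Definitions using (tri<; tri≈; tri>)
open import Relation.Binary.PropositionalEquality
  using (_≡_; _≢_; refl; sym; trans; cong; cong₂; subst; subst₂; module ≡-Reasoning)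
open import Relation.Nullary using (¬_; yes; no; does; contradiction)
open import Relation.Nullary.Decidable using (_×-dec_; ¬?; decidable-stable; dec-true; dec-false)
open import Relation.Unary using (Decidable)
open import Relation.Unary.Properties using (∁?)

linked-from-⊆ : ∀ {A : Set} {R : A → A → Set} (xs : List A) →
  (∀ {a b} → (a ∷ b ∷ []) ⊆ xs → R a b) → Linked R xs
linked-from-⊆ [] _ = []
linked-from-⊆ (x ∷ []) _ = [-]
linked-from-⊆ (x ∷ y ∷ xs) R-pairs =
  R-pairs (refl ∷ refl ∷ []⊆-universal xs) ∷ linked-from-⊆ (y ∷ xs) (λ s → R-pairs (x ∷ʳ s))

module _ {A : Set} {R : A → A → Set} where

  AllPairs-resp-⊆ : ∀ {xs ys} → xs ⊆ ys → AllPairs R ys → AllPairs R xs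
  AllPairs-resp-⊆ [] _ = []
  AllPairs-resp-⊆ (y ∷ʳ xs⊆ys) (_ ∷ rys) = AllPairs-resp-⊆ xs⊆ys rys
  AllPairs-resp-⊆ (refl ∷ xs⊆ys) (ry ∷ rys) = All-resp-⊆ xs⊆ys ry ∷ AllPairs-resp-⊆ xs⊆ys rys

  AllPairs-before : ∀ xs a ys → AllPairs R (xs ++ a ∷ ys) → ∀ {x} → x ∈ xs → R x a
  AllPairs-before xs a ys rs x∈xs
    with AllPairs-resp-⊆ (++⁺ (from∈ x∈xs) (refl ∷ []⊆-universal ys)) rs
  ... | (r ∷ []) ∷ _ = r

  AllPairs-after : ∀ xs a ys → AllPairs R (xs ++ a ∷ ys) → ∀ {y} → y ∈ ys → R a y
  AllPairs-after xs a ys rs y∈ys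
    with AllPairs-resp-⊆ (++⁺ ([]⊆-universal xs) (refl ∷ from∈ y∈ys)) rs
  ... | (r ∷ []) ∷ _ = r

module _ {A : Set} {P : A → Set} (P? : Decidable P) where

  sum-map-filter : ∀ (f : A → ℕ) xs →
    sum (map f xs) ≡ sum (map f (filter P? xs)) + sum (map f (filter (∁? P?) xs))
  sum-map-filter f [] = refl
  sum-map-filter f (x ∷ xs) with P? x
  ... | yes _ = trans (cong (f x +_) (sum-map-filter f xs)) (sym (+-assoc (f x) _ _))
  ... | no _ = trans (cong (f x +_) (sum-map-filter f xs))
                     (x∙yz≈y∙xz (f x) (sum (map f (filter P? xs))) (sum (map f (filter (∁? P?) xs))))

  length-filter-∁ : ∀ xs → length xs ≡ length (filter P? xs) + length (filter (∁? P?) xs)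
  length-filter-∁ [] = refl
  length-filter-∁ (x ∷ xs) with P? x
  ... | yes _ = cong suc (length-filter-∁ xs)
  ... | no _ = trans (cong suc (length-filter-∁ xs)) (sym (+-suc _ _))

sum-map-suc : ∀ {A : Set} (f g : A → ℕ) xs → (∀ {x} → x ∈ xs → f x ≡ suc (g x)) →
  sum (map f xs) ≡ length xs + sum (map g xs)
sum-map-suc f g [] _ = refl
sum-map-suc f g (x ∷ xs) f≡suc-g = begin
  f x + sum (map f xs)              ≡⟨ cong₂ _+_ (f≡suc-g (here refl)) (sum-map-suc f g xs (f≡suc-g ∘ there)) ⟩
  suc (g x) + (length xs + sum (map g xs)) ≡⟨ cong suc (x∙yz≈y∙xz (g x) (length xs) _) ⟩
  suc (length xs + (g x + sum (map g xs))) ∎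
  where open ≡-Reasoning

count-tabulate : ∀ {m} (s : Fin m → Bool) →
  Vec.count (_≟ᵇ true) (Vec.tabulate s) ≡ sum (tabulate (λ i → if s i then 1 else 0))
count-tabulate {zero} s = refl
count-tabulate {suc m} s with s zero
... | true = cong suc (count-tabulate (s ∘ suc))
... | false = count-tabulate (s ∘ suc)

-- The entry after position i in the list tabulate g ++ [ h ].
following : ∀ {A : Set} {m} → (Fin (suc m) → A) → A → Fin (suc m) → A
following {m = zero} g h zero = h
following {m = suc m} g h zero = g (suc zero)
following {m = suc m} g h (suc i) = following (g ∘ suc) h i

following-spec : ∀ {A : Set} {m} (g : Fin (suc m) → A) h i →
  (∃ λ j → toℕ j ≡ suc (toℕ i) × following g h i ≡ g j) ⊎ (toℕ i ≡ m × following g h i ≡ h)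
following-spec {m = zero} g h zero = inj₂ (refl , refl)
following-spec {m = suc m} g h zero = inj₁ (suc zero , refl , refl)
following-spec {m = suc m} g h (suc i) with following-spec (g ∘ suc) h i
... | inj₁ (j , j≡ , eq) = inj₁ (suc j , cong suc j≡ , eq)
... | inj₂ (i≡ , eq) = inj₂ (cong suc i≡ , eq)

cut-lengths : ∀ {A : Set} xs (a : A) ys b zs →
  length (a ∷ ys ++ [ b ]) + length (xs ++ a ∷ b ∷ zs) ≡ length (xs ++ a ∷ ys ++ b ∷ zs) + 2
cut-lengths xs a ys b zs
  rewrite length-++ ys {[ b ]} | length-++ xs {a ∷ b ∷ zs} | length-++ xs {a ∷ ys ++ b ∷ zs} | length-++ ys {b ∷ zs}
  = count (length xs) (length ys) (length zs)
  where
  count : ∀ p q r → suc (q + 1) + (p + suc (suc r)) ≡ (p + suc (q + suc r)) + 2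
  count = solve-∀

+-tight : ∀ {a b c d} → a ≤ c → b ≤ d → a + b ≡ c + d → a ≡ c × b ≡ d
+-tight {a} {b} {c} {d} a≤c b≤d sum≡ = a≡c , +-cancelˡ-≡ c b d (trans (cong (_+ b) (sym a≡c)) sum≡)
  where
  a≡c : a ≡ c
  a≡c = ≤-antisym a≤c (≮⇒≥ (λ a<c → <-irrefl sum≡ (+-mono-<-≤ a<c b≤d)))

-- The subdivision is only known to consist of interior-disjoint cells with n − 2 triangles in
-- total; the bound t + 2 ≤ v carried through the induction is what forces both halves of a
-- cut to be filled when the whole polygon is.
record FillingBound (t s l v f : ℕ) : Set where
  constructor fillingBound
  field
    fits  : t + 2 ≤ v
    tight : t + 2 ≡ v → s + 1 ≡ f + l

FillingBound-glue : ∀ {tA tB sA sB lA lB vA vB v fA fB f} →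
  FillingBound tA sA lA vA fA → FillingBound tB sB lB vB fB →
  vA + vB ≡ v + 2 → fA + fB ≡ f + 1 → FillingBound (tA + tB) (sA + sB) (lA + lB) v f
FillingBound-glue {tA} {tB} {sA} {sB} {lA} {lB} {vA} {vB} {v} {fA} {fB} {f}
  (fillingBound tA≤ fillA) (fillingBound tB≤ fillB) sides cut = fillingBound bound fill
  where
  shuffle : ∀ p q → (p + 2) + (q + 2) ≡ ((p + q) + 2) + 2
  shuffle = solve-∀
  bound : (tA + tB) + 2 ≤ v
  bound = +-cancelʳ-≤ 2 _ _ (subst₂ _≤_ (shuffle tA tB) sides (+-mono-≤ tA≤ tB≤))
  fill : (tA + tB) + 2 ≡ v → (sA + sB) + 1 ≡ f + (lA + lB)
  fill filled = +-cancelʳ-≡ 1 _ _ (begin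
    ((sA + sB) + 1) + 1   ≡⟨ regroup sA sB ⟩
    (sA + 1) + (sB + 1)   ≡⟨ cong₂ _+_ (fillA (proj₁ tight)) (fillB (proj₂ tight)) ⟩
    (fA + lA) + (fB + lB) ≡⟨ interchange fA lA fB lB ⟩
    (fA + fB) + (lA + lB) ≡⟨ cong (_+ (lA + lB)) cut ⟩
    (f + 1) + (lA + lB)   ≡⟨ xy∙z≈xz∙y f 1 (lA + lB) ⟩
    (f + (lA + lB)) + 1   ∎)
    where
    open ≡-Reasoning
    tight : tA + 2 ≡ vA × tB + 2 ≡ vB
    tight = +-tight tA≤ tB≤ (trans (trans (shuffle tA tB) (cong (_+ 2) filled)) (sym sides))
    regroup : ∀ p q → ((p + q) + 1) + 1 ≡ (p + 1) + (q + 1)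
    regroup = solve-∀

FillingBound-resp : ∀ {t t′ s s′ l l′ v f} → t ≡ t′ → s ≡ s′ → l ≡ l′ →
  FillingBound t′ s′ l′ v f → FillingBound t s l v f
FillingBound-resp refl refl refl bound = bound

shorter-part : ∀ {p q v} → p + q ≡ v + 2 → 3 ≤ q → p < v
shorter-part {p} {q} {v} sides 3≤q =
  +-cancelʳ-≤ 2 (suc p) v (subst₂ _≤_ (+-suc p 2) sides (+-monoʳ-≤ p 3≤q))

-- Cyclic descents of a ranked word

module Descents {A : Set} (rank : A → ℕ) (rank-injective : ∀ {a b} → rank a ≡ rank b → a ≡ b) where

  descent : A → A → ℕ
  descent a b = if does (rank b ℕ.<? rank a) then 1 else 0

  descent≡1 : ∀ {a b} → rank b < rank a → descent a b ≡ 1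
  descent≡1 {a} {b} b<a = cong (if_then 1 else 0) (dec-true (rank b ℕ.<? rank a) b<a)

  descent≡0 : ∀ {a b} → rank a < rank b → descent a b ≡ 0
  descent≡0 {a} {b} a<b = cong (if_then 1 else 0) (dec-false (rank b ℕ.<? rank a) (<-asym a<b))

  descent-flip : ∀ {a b} → a ≢ b → descent a b + descent b a ≡ 1
  descent-flip {a} {b} a≢b with <-cmp (rank a) (rank b)
  ... | tri< a<b _ _ rewrite descent≡0 a<b | descent≡1 a<b = refl
  ... | tri≈ _ a≈b _ = ⊥-elim (a≢b (rank-injective a≈b))
  ... | tri> _ _ b<a rewrite descent≡1 b<a | descent≡0 b<a = refl

  descents : List A → ℕ
  descents [] = 0
  descents (a ∷ []) = 0
  descents (a ∷ b ∷ as) = descent a b + descents (b ∷ as)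

  cyclicDescents : List A → ℕ
  cyclicDescents as = descents (as ++ take 1 as)

  descents-++ : ∀ xs a ys → descents (xs ++ a ∷ ys) ≡ descents (xs ++ [ a ]) + descents (a ∷ ys)
  descents-++ [] a ys = refl
  descents-++ (x ∷ []) a ys = sym (+-assoc (descent x a) 0 _)
  descents-++ (x ∷ y ∷ xs) a ys
    rewrite descents-++ (y ∷ xs) a ys = sym (+-assoc (descent x y) _ _)

  descents-tabulate : ∀ {m} (g : Fin (suc m) → A) h →
    descents (tabulate g ++ [ h ]) ≡ sum (tabulate (λ i → descent (g i) (following g h i)))
  descents-tabulate {zero} g h = refl
  descents-tabulate {suc m} g h = cong (descent (g zero) (g (suc zero)) +_) (descents-tabulate (g ∘ suc) h)

  take-1-++ : ∀ xs (a : A) ys → take 1 (xs ++ a ∷ ys) ≡ take 1 (xs ++ [ a ])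
  take-1-++ [] a ys = refl
  take-1-++ (x ∷ xs) a ys = refl

  cyclicDescents-++ : ∀ xs a ys → let h = take 1 (xs ++ [ a ]) in
    cyclicDescents (xs ++ a ∷ ys) ≡ descents (xs ++ [ a ]) + descents (a ∷ ys ++ h)
  cyclicDescents-++ xs a ys = begin
    descents ((xs ++ a ∷ ys) ++ take 1 (xs ++ a ∷ ys))
      ≡⟨ cong (λ t → descents ((xs ++ a ∷ ys) ++ t)) (take-1-++ xs a ys) ⟩
    descents ((xs ++ a ∷ ys) ++ h) ≡⟨ cong descents (++-assoc xs (a ∷ ys) h) ⟩
    descents (xs ++ a ∷ ys ++ h)   ≡⟨ descents-++ xs a (ys ++ h) ⟩
    descents (xs ++ [ a ]) + descents (a ∷ ys ++ h) ∎
    where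
    open ≡-Reasoning
    h = take 1 (xs ++ [ a ])

  -- The two halves share the paths a → … → b and b → … → a of the whole word,
  -- plus the steps a → b and b → a, exactly one of which is a descent.
  cyclicDescents-cut : ∀ xs a ys b zs → a ≢ b →
    cyclicDescents (a ∷ ys ++ [ b ]) + cyclicDescents (xs ++ a ∷ b ∷ zs)
      ≡ cyclicDescents (xs ++ a ∷ ys ++ b ∷ zs) + 1
  cyclicDescents-cut xs a ys b zs a≢b = begin
      cyclicDescents (a ∷ ys ++ [ b ]) + cyclicDescents (xs ++ a ∷ b ∷ zs)
        ≡⟨ cong₂ _+_ inner (cyclicDescents-++ xs a (b ∷ zs)) ⟩
      (aYb + (descent b a + 0)) + (Xa + (descent a b + bZ))
        ≡⟨ rearrange aYb (descent b a) Xa (descent a b) bZ ⟩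
      (Xa + (aYb + bZ)) + (descent a b + descent b a)
        ≡⟨ cong₂ _+_ (sym whole) (descent-flip a≢b) ⟩
      cyclicDescents (xs ++ a ∷ ys ++ b ∷ zs) + 1 ∎
    where
    open ≡-Reasoning
    h = take 1 (xs ++ [ a ])
    Xa = descents (xs ++ [ a ])
    aYb = descents (a ∷ ys ++ [ b ])
    bZ = descents (b ∷ zs ++ h)
    rearrange : ∀ p q r s t → (p + (q + 0)) + (r + (s + t)) ≡ (r + (p + t)) + (s + q)
    rearrange = solve-∀
    inner : cyclicDescents (a ∷ ys ++ [ b ]) ≡ aYb + (descent b a + 0)
    inner = trans (cong descents (++-assoc (a ∷ ys) [ b ] [ a ])) (descents-++ (a ∷ ys) b [ a ])
    whole : cyclicDescents (xs ++ a ∷ ys ++ b ∷ zs) ≡ Xa + (aYb + bZ)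
    whole = trans (cyclicDescents-++ xs a (ys ++ b ∷ zs))
      (cong (Xa +_) (trans (cong (λ t → descents (a ∷ t)) (++-assoc ys (b ∷ zs) h))
                           (descents-++ (a ∷ ys) b (zs ++ h))))

  cyclicDescents-pair : ∀ {a b} → a ≢ b → cyclicDescents (a ∷ b ∷ []) ≡ 1
  cyclicDescents-pair {a} {b} a≢b =
    trans (cong (descent a b +_) (+-identityʳ (descent b a))) (descent-flip a≢b)

  Clockwise : A → A → A → Set
  Clockwise a b c = rank a < rank b × rank b < rank c
                  ⊎ rank b < rank c × rank c < rank a
                  ⊎ rank c < rank a × rank a < rank b

  Clockwise⇒≢ : ∀ {a b c} → Clockwise a b c → a ≢ b
  Clockwise⇒≢ (inj₁ (a<b , _)) refl = <-irrefl refl a<b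
  Clockwise⇒≢ (inj₂ (inj₁ (b<c , c<a))) refl = <-asym b<c c<a
  Clockwise⇒≢ (inj₂ (inj₂ (_ , a<b))) refl = <-irrefl refl a<b

  Clockwise-rotate : ∀ {a b c} → Clockwise a b c → Clockwise b c a
  Clockwise-rotate (inj₁ p) = inj₂ (inj₂ p)
  Clockwise-rotate (inj₂ (inj₁ p)) = inj₁ p
  Clockwise-rotate (inj₂ (inj₂ p)) = inj₂ (inj₁ p)

  descent-clockwise : ∀ {x b d} → Clockwise x b d → descent b d + descent d x ≡ descent b x
  descent-clockwise (inj₁ (x<b , b<d))
    rewrite descent≡0 b<d | descent≡1 (<-trans x<b b<d) | descent≡1 x<b = refl
  descent-clockwise (inj₂ (inj₁ (b<d , d<x)))
    rewrite descent≡0 b<d | descent≡0 d<x | descent≡0 (<-trans b<d d<x) = refl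
  descent-clockwise (inj₂ (inj₂ (d<x , x<b)))
    rewrite descent≡1 (<-trans d<x x<b) | descent≡0 d<x | descent≡1 x<b = refl

  descent-anticlockwise : ∀ {x b d} → Clockwise d b x → descent b d + descent d x ≡ 1 + descent b x
  descent-anticlockwise (inj₁ (d<b , b<x))
    rewrite descent≡1 d<b | descent≡0 (<-trans d<b b<x) | descent≡0 b<x = refl
  descent-anticlockwise (inj₂ (inj₁ (b<x , x<d)))
    rewrite descent≡0 (<-trans b<x x<d) | descent≡1 x<d | descent≡0 b<x = refl
  descent-anticlockwise (inj₂ (inj₂ (x<d , d<b)))
    rewrite descent≡1 d<b | descent≡1 x<d | descent≡1 (<-trans x<d d<b) = refl

  descents-fan : ∀ c x y ys →
    Linked (λ b d → descent b d + descent d x ≡ c + descent b x) (y ∷ ys) →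
    descents (y ∷ ys ++ [ x ]) ≡ length ys * c + descent y x
  descents-fan c x y [] _ = +-identityʳ (descent y x)
  descents-fan c x y (z ∷ zs) (step ∷ fan) = begin
    descent y z + descents (z ∷ zs ++ [ x ])      ≡⟨ cong (descent y z +_) (descents-fan c x z zs fan) ⟩
    descent y z + (length zs * c + descent z x)   ≡⟨ x∙yz≈y∙xz (descent y z) (length zs * c) (descent z x) ⟩
    length zs * c + (descent y z + descent z x)   ≡⟨ cong (length zs * c +_) step ⟩
    length zs * c + (c + descent y x)             ≡⟨ x∙yz≈yx∙z (length zs * c) c (descent y x) ⟩
    (c + length zs * c) + descent y x             ∎
    where open ≡-Reasoning

  cyclicDescents-clockwise : ∀ vs → 3 ≤ length vs →
    (∀ {a b c} → (a ∷ b ∷ c ∷ []) ⊆ vs → Clockwise a b c) → cyclicDescents vs ≡ 1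
  cyclicDescents-clockwise [] () _
  cyclicDescents-clockwise (_ ∷ []) (s≤s ()) _
  cyclicDescents-clockwise (_ ∷ _ ∷ []) (s≤s (s≤s ())) _
  cyclicDescents-clockwise (x ∷ y ∷ z ∷ zs) _ clockwise = begin
    descent x y + descents (y ∷ z ∷ zs ++ [ x ])      ≡⟨ cong (descent x y +_) (descents-fan 0 x y (z ∷ zs) fan) ⟩
    descent x y + (length zs * 0 + descent y x)
      ≡⟨ cong (λ t → descent x y + (t + descent y x)) (*-zeroʳ (length zs)) ⟩
    descent x y + descent y x                         ≡⟨ descent-flip x≢y ⟩
    1                                                 ∎
    where
    open ≡-Reasoning
    fan : Linked (λ b d → descent b d + descent d x ≡ 0 + descent b x) (y ∷ z ∷ zs)
    fan = linked-from-⊆ (y ∷ z ∷ zs) (λ s → descent-clockwise (clockwise (refl ∷ s)))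
    x≢y : x ≢ y
    x≢y = Clockwise⇒≢ (clockwise (refl ∷ refl ∷ refl ∷ []⊆-universal zs))

  cyclicDescents-anticlockwise : ∀ vs → 3 ≤ length vs →
    (∀ {a b c} → (a ∷ b ∷ c ∷ []) ⊆ vs → Clockwise c b a) → cyclicDescents vs ≡ suc (length vs ∸ 2)
  cyclicDescents-anticlockwise [] () _
  cyclicDescents-anticlockwise (_ ∷ []) (s≤s ()) _
  cyclicDescents-anticlockwise (_ ∷ _ ∷ []) (s≤s (s≤s ())) _
  cyclicDescents-anticlockwise (x ∷ y ∷ z ∷ zs) _ anticlockwise = begin
    descent x y + descents (y ∷ z ∷ zs ++ [ x ])        ≡⟨ cong (descent x y +_) (descents-fan 1 x y (z ∷ zs) fan) ⟩
    descent x y + (suc (length zs) * 1 + descent y x)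
      ≡⟨ cong (λ t → descent x y + (t + descent y x)) (*-identityʳ (suc (length zs))) ⟩
    descent x y + (suc (length zs) + descent y x)       ≡⟨ x∙yz≈xz∙y (descent x y) (suc (length zs)) (descent y x) ⟩
    (descent x y + descent y x) + suc (length zs)       ≡⟨ cong (_+ suc (length zs)) (descent-flip x≢y) ⟩
    2 + length zs                                       ∎
    where
    open ≡-Reasoning
    fan : Linked (λ b d → descent b d + descent d x ≡ 1 + descent b x) (y ∷ z ∷ zs)
    fan = linked-from-⊆ (y ∷ z ∷ zs) (λ s → descent-anticlockwise (anticlockwise (refl ∷ s)))
    x≢y : x ≢ y
    x≢y refl = Clockwise⇒≢ (Clockwise-rotate (anticlockwise (refl ∷ refl ∷ refl ∷ []⊆-universal zs))) refl

-- Chords of a convex polygon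

module _ {n : ℕ} where

  Increasing : List (Fin n) → Set
  Increasing = AllPairs Fin._<_

  verts-increasing : (P : Cell n) → Increasing (verts P)
  verts-increasing P = Linked⇒AllPairs <-trans (increasing P)

  Increasing-≡ : ∀ {xs ys} → Increasing xs → Increasing ys →
    (∀ {z} → z ∈ xs → z ∈ ys) → (∀ {z} → z ∈ ys → z ∈ xs) → xs ≡ ys
  Increasing-≡ {[]} {[]} _ _ _ _ = refl
  Increasing-≡ {[]} {y ∷ ys} _ _ _ ys⊆xs with ys⊆xs (here refl)
  ... | ()
  Increasing-≡ {x ∷ xs} {[]} _ _ xs⊆ys _ with xs⊆ys (here refl)
  ... | ()
  Increasing-≡ {x ∷ xs} {y ∷ ys} (x<xs ∷ sxs) (y<ys ∷ sys) xs⊆ys ys⊆xs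
    with xs⊆ys (here refl) | ys⊆xs (here refl)
  ... | there x∈ys | there y∈xs = ⊥-elim (<-asym (lookup y<ys x∈ys) (lookup x<xs y∈xs))
  ... | there x∈ys | here refl  = ⊥-elim (<-irrefl refl (lookup y<ys x∈ys))
  ... | here refl  | _          = cong (x ∷_) (Increasing-≡ sxs sys (tail-⊆ x<xs xs⊆ys) (tail-⊆ y<ys ys⊆xs))
    where
    tail-⊆ : ∀ {x us vs} → All (x Fin.<_) us → (∀ {z} → z ∈ x ∷ us → z ∈ x ∷ vs) →
      ∀ {z} → z ∈ us → z ∈ vs
    tail-⊆ x<us us⊆vs z∈us with us⊆vs (there z∈us)
    ... | here refl = ⊥-elim (<-irrefl refl (lookup x<us z∈us))
    ... | there z∈vs = z∈vs

  Inside : Fin n → Fin n → Fin n → Set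
  Inside a b z = a Fin.< z × z Fin.< b

  Outside : Fin n → Fin n → Fin n → Set
  Outside a b z = z Fin.< a ⊎ b Fin.< z

  ¬Outside : ∀ {a b z} → a Fin.≤ z → z Fin.≤ b → ¬ Outside a b z
  ¬Outside a≤z _ (inj₁ z<a) = <⇒≱ z<a a≤z
  ¬Outside _ z≤b (inj₂ b<z) = <⇒≱ b<z z≤b

  inside? : ∀ a b → Decidable (Inside a b)
  inside? a b z = (a Fin.<? z) ×-dec (z Fin.<? b)

  OnOneSide : Fin n → Fin n → List (Fin n) → Set
  OnOneSide a b vs = (∀ {z} → z ∈ vs → ¬ Inside a b z) ⊎ (∀ {z} → z ∈ vs → ¬ Outside a b z)

  -- If both sides held a vertex of Q, the chord ab of P would cross a chord of Q.
  disjoint⇒onOneSide : ∀ {P Q} → InteriorDisjoint P Q → ∀ {a b} → a ∈ verts P → b ∈ verts P →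
    OnOneSide a b (verts Q)
  disjoint⇒onOneSide {P = P} {Q = Q} (¬PQ , ¬QP , _) {a} {b} a∈P b∈P with any? (inside? a b) (verts Q)
  ... | no ¬inside = inj₁ (λ z∈Q z-in → ¬inside (lose z∈Q z-in))
  ... | yes inside with find inside
  ...   | x , x∈Q , (a<x , x<b) = inj₂ noOutside
    where
    noOutside : ∀ {z} → z ∈ verts Q → ¬ Outside a b z
    noOutside {z} z∈Q (inj₁ z<a) = ¬QP (z , a , x , b , z∈Q , a∈P , x∈Q , b∈P , z<a , a<x , x<b)
    noOutside {z} z∈Q (inj₂ b<z) = ¬PQ (a , x , b , z , a∈P , x∈Q , b∈P , z∈Q , a<x , x<b , b<z)

  record SeparatingChord (V vs : List (Fin n)) : Set where
    field
      a b         : Fin n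
      a∈vs        : a ∈ vs
      b∈vs        : b ∈ vs
      a<b         : a Fin.< b
      inner outer : Fin n
      inner∈V     : inner ∈ V
      outer∈V     : outer ∈ V
      inner-in    : Inside a b inner
      outer-out   : Outside a b outer
      vs-one-side : OnOneSide a b vs

  consecutive-around : ∀ u c cs → Increasing (c ∷ cs) → c Fin.< u → Any (u Fin.<_) (c ∷ cs) →
    ¬ u ∈ c ∷ cs → ∃₂ λ pre a → ∃₂ λ b post → c ∷ cs ≡ pre ++ a ∷ b ∷ post × Inside a b u
  consecutive-around u c [] _ c<u (here u<c) _ = ⊥-elim (<-asym c<u u<c)
  consecutive-around u c (d ∷ ds) (_ ∷ sorted) c<u above u∉ with Finₚ.<-cmp u d
  ... | tri< u<d _ _ = [] , c , d , ds , refl , c<u , u<d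
  ... | tri≈ _ refl _ = ⊥-elim (u∉ (there (here refl)))
  ... | tri> _ _ d<u with above
  ...   | here u<c = ⊥-elim (<-asym c<u u<c)
  ...   | there above′ with consecutive-around u d ds sorted d<u above′ (u∉ ∘ there)
  ...     | pre , a , b , post , eq , a<u<b = c ∷ pre , a , b , post , cong (c ∷_) eq , a<u<b

  none-between : ∀ pre a b post → Increasing (pre ++ a ∷ b ∷ post) →
    ∀ {z} → z ∈ pre ++ a ∷ b ∷ post → ¬ Inside a b z
  none-between pre a b post sorted z∈ (a<z , z<b) with ∈-++⁻ pre z∈
  ... | inj₁ z∈pre = <-asym a<z (AllPairs-before pre a (b ∷ post) sorted z∈pre)
  ... | inj₂ (here refl) = <-irrefl refl a<z
  ... | inj₂ (there (here refl)) = <-irrefl refl z<b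
  ... | inj₂ (there (there z∈post)) =
    <-asym z<b (AllPairs-after (pre ++ [ a ]) b post (subst Increasing (sym (++-assoc pre [ a ] (b ∷ post))) sorted) z∈post)

  some-outside : ∀ pre a b post → Increasing (pre ++ a ∷ b ∷ post) → 3 ≤ length (pre ++ a ∷ b ∷ post) →
    ∃ λ y → y ∈ pre ++ a ∷ b ∷ post × Outside a b y
  some-outside (q ∷ pre) a b post sorted _ =
    q , here refl , inj₁ (AllPairs-before (q ∷ pre) a (b ∷ post) sorted (here refl))
  some-outside [] a b (q ∷ post) sorted _ =
    q , there (there (here refl)) , inj₂ (AllPairs-after [ a ] b (q ∷ post) sorted (here refl))
  some-outside [] a b [] _ (s≤s (s≤s ()))

  consecutive-chord : ∀ {V} pre a b post → Increasing (pre ++ a ∷ b ∷ post) → 3 ≤ length (pre ++ a ∷ b ∷ post) →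
    (∀ {z} → z ∈ pre ++ a ∷ b ∷ post → z ∈ V) → ∀ {u} → u ∈ V → Inside a b u →
    SeparatingChord V (pre ++ a ∷ b ∷ post)
  consecutive-chord pre a b post sorted len vs⊆V {u} u∈V u-in with some-outside pre a b post sorted len
  ... | y , y∈vs , y-out = record
    { a = a ; b = b ; a∈vs = ∈-++⁺ʳ pre (here refl) ; b∈vs = ∈-++⁺ʳ pre (there (here refl))
    ; a<b = <-trans (proj₁ u-in) (proj₂ u-in)
    ; inner = u ; outer = y ; inner∈V = u∈V ; outer∈V = vs⊆V y∈vs ; inner-in = u-in ; outer-out = y-out
    ; vs-one-side = inj₁ (none-between pre a b post sorted) }

  extreme-chord : ∀ {V} a m mid b → Increasing (a ∷ (m ∷ mid) ++ [ b ]) →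
    (∀ {z} → z ∈ a ∷ (m ∷ mid) ++ [ b ] → z ∈ V) → ∀ {u} → u ∈ V → Outside a b u →
    SeparatingChord V (a ∷ (m ∷ mid) ++ [ b ])
  extreme-chord a m mid b sorted@(a<vs ∷ m<vs) vs⊆V {u} u∈V u-out = record
    { a = a ; b = b ; a∈vs = here refl ; b∈vs = there b∈ ; a<b = lookup a<vs b∈
    ; inner = m ; outer = u ; inner∈V = vs⊆V (there (here refl)) ; outer∈V = u∈V
    ; inner-in = lookup a<vs (here refl) , AllPairs-before (m ∷ mid) b [] m<vs (here refl)
    ; outer-out = u-out ; vs-one-side = inj₂ none-outside }
    where
    b∈ : b ∈ (m ∷ mid) ++ [ b ]
    b∈ = ∈-++⁺ʳ (m ∷ mid) (here refl)
    none-outside : ∀ {z} → z ∈ a ∷ (m ∷ mid) ++ [ b ] → ¬ Outside a b z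
    none-outside (here refl) (inj₁ z<a) = <-irrefl refl z<a
    none-outside (here refl) (inj₂ b<z) = <-asym b<z (lookup a<vs b∈)
    none-outside (there z∈) (inj₁ z<a) = <-asym z<a (lookup a<vs z∈)
    none-outside (there z∈) (inj₂ b<z) with ∈-++⁻ (m ∷ mid) z∈
    ... | inj₁ z∈mid = <-asym b<z (AllPairs-before (m ∷ mid) b [] m<vs z∈mid)
    ... | inj₂ (here refl) = <-irrefl refl b<z

  separating-chord : ∀ {V} vs → Increasing vs → 3 ≤ length vs → (∀ {z} → z ∈ vs → z ∈ V) →
    ∀ {u} → u ∈ V → ¬ u ∈ vs → SeparatingChord V vs
  separating-chord vs sorted len vs⊆V {u} u∈V u∉ with initLast vs
  separating-chord _ sorted len vs⊆V {u} u∈V u∉ | (a ∷ m ∷ mid) ∷ʳ′ b with Finₚ.<-cmp u a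
  ... | tri< u<a _ _ = extreme-chord a m mid b sorted vs⊆V u∈V (inj₁ u<a)
  ... | tri≈ _ refl _ = ⊥-elim (u∉ (here refl))
  ... | tri> _ _ a<u with Finₚ.<-cmp u b
  ...   | tri> _ _ b<u = extreme-chord a m mid b sorted vs⊆V u∈V (inj₂ b<u)
  ...   | tri≈ _ refl _ = ⊥-elim (u∉ b∈vs)
    where
    b∈vs : b ∈ a ∷ (m ∷ mid) ++ [ b ]
    b∈vs = there (∈-++⁺ʳ (m ∷ mid) (here refl))
  ...   | tri< u<b _ _
          with consecutive-around u a ((m ∷ mid) ++ [ b ]) sorted a<u
                 (lose (there (∈-++⁺ʳ (m ∷ mid) (here refl))) u<b) u∉
  ...     | pre , a′ , b′ , post , vs≡ , u-in =
    subst (SeparatingChord _) (sym vs≡)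
      (consecutive-chord pre a′ b′ post (subst Increasing vs≡ sorted) (subst (λ vs → 3 ≤ length vs) vs≡ len)
        (vs⊆V ∘ subst (_ ∈_) (sym vs≡)) u∈V u-in)
  separating-chord _ _ () _ _ _ | []
  separating-chord _ _ (s≤s ()) _ _ _ | [] ∷ʳ′ _
  separating-chord _ _ (s≤s (s≤s ())) _ _ _ | (_ ∷ []) ∷ʳ′ _

  data Region (xs ys zs : List (Fin n)) (a b z : Fin n) : Set where
    left    : z ∈ xs → z Fin.< a → Region xs ys zs a b z
    at-a    : z ≡ a → Region xs ys zs a b z
    between : z ∈ ys → Inside a b z → Region xs ys zs a b z
    at-b    : z ≡ b → Region xs ys zs a b z
    right   : z ∈ zs → b Fin.< z → Region xs ys zs a b z

  region : ∀ xs a ys b zs → Increasing (xs ++ a ∷ ys ++ b ∷ zs) →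
    ∀ {z} → z ∈ xs ++ a ∷ ys ++ b ∷ zs → Region xs ys zs a b z
  region xs a ys b zs sorted z∈ with ∈-++⁻ xs z∈
  ... | inj₁ z∈xs = left z∈xs (AllPairs-before xs a (ys ++ b ∷ zs) sorted z∈xs)
  ... | inj₂ (here refl) = at-a refl
  ... | inj₂ (there z∈′) with ∈-++⁻ ys z∈′
  ...   | inj₁ z∈ys = between z∈ys
                        (AllPairs-after xs a (ys ++ b ∷ zs) sorted (∈-++⁺ˡ z∈ys) ,
                         AllPairs-before ys b zs (AllPairs-resp-⊆ (++⁺ˡ (xs ++ [ a ]) ⊆-refl) sorted′) z∈ys)
    where
    sorted′ : Increasing ((xs ++ [ a ]) ++ ys ++ b ∷ zs)
    sorted′ = subst Increasing (sym (++-assoc xs [ a ] (ys ++ b ∷ zs))) sorted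
  ...   | inj₂ (here refl) = at-b refl
  ...   | inj₂ (there z∈zs) = right z∈zs (AllPairs-after (xs ++ a ∷ ys) b zs sorted″ z∈zs)
    where
    sorted″ : Increasing ((xs ++ a ∷ ys) ++ b ∷ zs)
    sorted″ = subst Increasing (sym (++-assoc xs (a ∷ ys) (b ∷ zs))) sorted

  inner-length : ∀ xs a ys b zs → Increasing (xs ++ a ∷ ys ++ b ∷ zs) →
    ∀ {x} → x ∈ xs ++ a ∷ ys ++ b ∷ zs → Inside a b x → 3 ≤ length (a ∷ ys ++ [ b ])
  inner-length xs a ys b zs sorted x∈ (a<x , x<b) with region xs a ys b zs sorted x∈
  ... | between x∈ys _ = length-mono-≤ {bs = a ∷ ys ++ [ b ]} (refl ∷ ++⁺ (from∈ x∈ys) ⊆-refl)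
  ... | left _ x<a = ⊥-elim (<-asym x<a a<x)
  ... | at-a refl = ⊥-elim (<-irrefl refl a<x)
  ... | at-b refl = ⊥-elim (<-irrefl refl x<b)
  ... | right _ b<x = ⊥-elim (<-asym b<x x<b)

  outer-length : ∀ xs a ys b zs → Increasing (xs ++ a ∷ ys ++ b ∷ zs) → a Fin.< b →
    ∀ {y} → y ∈ xs ++ a ∷ ys ++ b ∷ zs → Outside a b y → 3 ≤ length (xs ++ a ∷ b ∷ zs)
  outer-length xs a ys b zs sorted a<b y∈ y-out with region xs a ys b zs sorted y∈
  ... | left y∈xs _ = length-mono-≤ (++⁺ (from∈ y∈xs) (refl ∷ refl ∷ []⊆-universal zs))
  ... | right y∈zs _ = length-mono-≤ (++⁺ˡ xs (refl ∷ refl ∷ from∈ y∈zs))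
  ... | at-a refl = ⊥-elim (¬Outside ≤-refl (<⇒≤ a<b) y-out)
  ... | between _ (a<y , y<b) = ⊥-elim (¬Outside (<⇒≤ a<y) (<⇒≤ y<b) y-out)
  ... | at-b refl = ⊥-elim (¬Outside (<⇒≤ a<b) ≤-refl y-out)

  split-at-chord : ∀ {V} → Increasing V → ∀ {a b} → a ∈ V → b ∈ V → a Fin.< b →
    ∃₂ λ xs ys → ∃ λ zs → V ≡ xs ++ a ∷ ys ++ b ∷ zs
  split-at-chord sorted {a} {b} a∈ b∈ a<b with ∈-∃++ a∈
  ... | xs , rest , refl with ∈-++⁻ xs b∈
  ...   | inj₁ b∈xs = ⊥-elim (<-asym a<b (AllPairs-before xs a rest sorted b∈xs))
  ...   | inj₂ (here refl) = ⊥-elim (<-irrefl refl a<b)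
  ...   | inj₂ (there b∈rest) with ∈-∃++ b∈rest
  ...     | ys , zs , refl = xs , ys , zs , refl

-- Dissections

module Dissection {n : ℕ} (φ : List (Fin n) → ℕ)
  (φ-pair : ∀ {a b} → a Fin.< b → φ (a ∷ b ∷ []) ≡ 1)
  (φ-cut : ∀ xs a ys b zs → a Fin.< b →
    φ (a ∷ ys ++ [ b ]) + φ (xs ++ a ∷ b ∷ zs) ≡ φ (xs ++ a ∷ ys ++ b ∷ zs) + 1) where

  open DecMembership (Finₚ._≟_ {n}) using (_∈?_)

  triangleCount : List (Cell n) → ℕ
  triangleCount cs = sum (map triangles cs)

  weight : List (Cell n) → ℕ
  weight cs = sum (map (φ ∘ verts) cs)

  DissectionBound : List (Cell n) → List (Fin n) → Set
  DissectionBound cs V = FillingBound (triangleCount cs) (weight cs) (length cs) (length V) (φ V)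

  Within : List (Cell n) → List (Fin n) → Set
  Within cs V = ∀ {Q} → Q ∈ cs → ∀ {z} → z ∈ verts Q → z ∈ V

  DissectionsBounded : List (Fin n) → Set
  DissectionsBounded V = Increasing V → 2 ≤ length V →
    ∀ cs → AllPairs InteriorDisjoint cs → Within cs V → DissectionBound cs V

  bound-empty : ∀ {V} → Increasing V → 2 ≤ length V → DissectionBound [] V
  bound-empty sorted 2≤ = fillingBound 2≤ (edge sorted)
    where
    edge : ∀ {V} → Increasing V → 2 ≡ length V → 1 ≡ φ V + 0
    edge {a ∷ b ∷ []} ((a<b ∷ []) ∷ _) refl = sym (trans (+-identityʳ _) (φ-pair a<b))
    edge {[]} _ ()
    edge {_ ∷ []} _ ()
    edge {_ ∷ _ ∷ _ ∷ _} _ ()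

  three-vertices : ∀ (Q : Cell n) → ∃₂ λ x y → ∃ λ z →
    x ∈ verts Q × y ∈ verts Q × z ∈ verts Q × x Fin.< y × y Fin.< z
  three-vertices Q with verts Q | verts-increasing Q | atLeast3 Q
  ... | x ∷ y ∷ z ∷ _ | (x<vs ∷ y<vs ∷ _) | _ =
    x , y , z , here refl , there (here refl) , there (there (here refl)) ,
    lookup x<vs (here refl) , lookup y<vs (here refl)
  ... | [] | _ | ()
  ... | _ ∷ [] | _ | s≤s ()
  ... | _ ∷ _ ∷ [] | _ | s≤s (s≤s ())

  -- A second cell would share three vertices with P.
  bound-whole : ∀ {V} → Increasing V → ∀ P rest → AllPairs InteriorDisjoint (P ∷ rest) → Within (P ∷ rest) V →
    (∀ {u} → u ∈ V → u ∈ verts P) → DissectionBound (P ∷ rest) V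
  bound-whole sorted P (Q ∷ rest) (P#rest ∷ _) within V⊆P with three-vertices Q
  ... | x , y , z , x∈ , y∈ , z∈ , x<y , y<z =
    ⊥-elim (proj₂ (proj₂ (lookup P#rest (here refl)))
      (x , y , z , P∋ x∈ , P∋ y∈ , P∋ z∈ , x∈ , y∈ , z∈ , x<y , y<z))
    where
    P∋ : ∀ {v} → v ∈ verts Q → v ∈ verts P
    P∋ = V⊆P ∘ within (there (here refl))
  bound-whole {V} sorted P [] _ within V⊆P =
    subst (DissectionBound (P ∷ [])) P≡V (fillingBound (≤-reflexive triangles+2) (λ _ → cong (_+ 1) (+-identityʳ _)))
    where
    P≡V : verts P ≡ V
    P≡V = Increasing-≡ (verts-increasing P) sorted (within (here refl)) V⊆P
    triangles+2 : (triangles P + 0) + 2 ≡ length (verts P)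
    triangles+2 = trans (cong (_+ 2) (+-identityʳ _)) (m∸n+n≡m (≤-trans (n≤1+n 2) (atLeast3 P)))

  HasInside : Fin n → Fin n → Cell n → Set
  HasInside a b Q = Any (Inside a b) (verts Q)

  hasInside? : ∀ a b → Decidable (HasInside a b)
  hasInside? a b Q = any? (inside? a b) (verts Q)

  within-inner : ∀ xs a ys b zs → Increasing (xs ++ a ∷ ys ++ b ∷ zs) →
    ∀ {cs} → Within cs (xs ++ a ∷ ys ++ b ∷ zs) → (∀ {Q} → Q ∈ cs → OnOneSide a b (verts Q)) →
    Within (filter (hasInside? a b) cs) (a ∷ ys ++ [ b ])
  within-inner xs a ys b zs sorted within one-sided Q∈ z∈Q with ∈-filter⁻ (hasInside? a b) Q∈
  ... | Q∈cs , reaches-in with one-sided Q∈cs | find reaches-in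
  ...   | inj₁ none-in | _ , w∈Q , w-in = ⊥-elim (none-in w∈Q w-in)
  ...   | inj₂ none-out | _ with region xs a ys b zs sorted (within Q∈cs z∈Q)
  ...     | left _ z<a = ⊥-elim (none-out z∈Q (inj₁ z<a))
  ...     | at-a refl = here refl
  ...     | between z∈ys _ = there (∈-++⁺ˡ z∈ys)
  ...     | at-b refl = there (∈-++⁺ʳ ys (here refl))
  ...     | right _ b<z = ⊥-elim (none-out z∈Q (inj₂ b<z))

  within-outer : ∀ xs a ys b zs → Increasing (xs ++ a ∷ ys ++ b ∷ zs) →
    ∀ {cs} → Within cs (xs ++ a ∷ ys ++ b ∷ zs) → Within (filter (∁? (hasInside? a b)) cs) (xs ++ a ∷ b ∷ zs)
  within-outer xs a ys b zs sorted within Q∈ z∈Q with ∈-filter⁻ (∁? (hasInside? a b)) Q∈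
  ... | Q∈cs , no-inside with region xs a ys b zs sorted (within Q∈cs z∈Q)
  ...   | left z∈xs _ = ∈-++⁺ˡ z∈xs
  ...   | at-a refl = ∈-++⁺ʳ xs (here refl)
  ...   | between _ z-in = ⊥-elim (no-inside (lose z∈Q z-in))
  ...   | at-b refl = ∈-++⁺ʳ xs (there (here refl))
  ...   | right z∈zs _ = ∈-++⁺ʳ xs (there (there z∈zs))

  bound-cut : ∀ {V} xs a ys b zs → V ≡ xs ++ a ∷ ys ++ b ∷ zs →
    (∀ {W} → length W < length V → DissectionsBounded W) → Increasing V → a Fin.< b →
    ∀ cs → AllPairs InteriorDisjoint cs → Within cs V → (∀ {Q} → Q ∈ cs → OnOneSide a b (verts Q)) →
    ∀ {x y} → x ∈ V → Inside a b x → y ∈ V → Outside a b y → DissectionBound cs V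
  bound-cut xs a ys b zs refl ih sorted a<b cs disjoint within one-sided x∈ x-in y∈ y-out =
    FillingBound-resp (sum-map-filter (hasInside? a b) triangles cs)
                      (sum-map-filter (hasInside? a b) (φ ∘ verts) cs)
                      (length-filter-∁ (hasInside? a b) cs)
      (FillingBound-glue inner-bound outer-bound sides (φ-cut xs a ys b zs a<b))
    where
    inner = a ∷ ys ++ [ b ]
    outer = xs ++ a ∷ b ∷ zs
    csIn = filter (hasInside? a b) cs
    csOut = filter (∁? (hasInside? a b)) cs
    sides : length inner + length outer ≡ length (xs ++ a ∷ ys ++ b ∷ zs) + 2
    sides = cut-lengths xs a ys b zs
    3≤inner : 3 ≤ length inner
    3≤inner = inner-length xs a ys b zs sorted x∈ x-in
    3≤outer : 3 ≤ length outer
    3≤outer = outer-length xs a ys b zs sorted a<b y∈ y-out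
    inner-sorted : Increasing inner
    inner-sorted = AllPairs-resp-⊆ (++⁺ˡ xs (refl ∷ ++⁺ ⊆-refl (refl ∷ []⊆-universal zs))) sorted
    outer-sorted : Increasing outer
    outer-sorted = AllPairs-resp-⊆ (++⁺ ⊆-refl (refl ∷ ++⁺ˡ ys ⊆-refl)) sorted
    inner-bound : DissectionBound csIn inner
    inner-bound = ih (shorter-part sides 3≤outer) inner-sorted (≤-trans (n≤1+n 2) 3≤inner)
      csIn (filter⁺ (hasInside? a b) disjoint) (within-inner xs a ys b zs sorted within one-sided)
    outer-bound : DissectionBound csOut outer
    outer-bound = ih (shorter-part (trans (+-comm (length outer) (length inner)) sides) 3≤inner)
      outer-sorted (≤-trans (n≤1+n 2) 3≤outer)
      csOut (filter⁺ (∁? (hasInside? a b)) disjoint) (within-outer xs a ys b zs sorted within)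

  bound-chord : ∀ {V} → (∀ {W} → length W < length V → DissectionsBounded W) → Increasing V →
    ∀ P rest → AllPairs InteriorDisjoint (P ∷ rest) → Within (P ∷ rest) V →
    SeparatingChord V (verts P) → DissectionBound (P ∷ rest) V
  bound-chord ih sorted P rest disjoint@(P#rest ∷ _) within
    record { a = a ; b = b ; a∈vs = a∈vs ; b∈vs = b∈vs ; a<b = a<b ; inner∈V = inner∈V ; outer∈V = outer∈V
           ; inner-in = inner-in ; outer-out = outer-out ; vs-one-side = vs-one-side }
    with split-at-chord sorted (within (here refl) a∈vs) (within (here refl) b∈vs) a<b
  ... | xs , ys , zs , V≡ =
    bound-cut xs a ys b zs V≡ ih sorted a<b (P ∷ rest) disjoint within one-sided inner∈V inner-in outer∈V outer-out
    where
    one-sided : ∀ {Q} → Q ∈ P ∷ rest → OnOneSide a b (verts Q)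
    one-sided (here refl) = vs-one-side
    one-sided {Q} (there Q∈) = disjoint⇒onOneSide {P = P} {Q = Q} (lookup P#rest Q∈) a∈vs b∈vs

  dissection-bound : ∀ V → DissectionsBounded V
  dissection-bound = All.wfRec (On.wellFounded length <-wellFounded) 0ℓ DissectionsBounded step
    where
    step : ∀ V → (∀ {W} → length W < length V → DissectionsBounded W) → DissectionsBounded V
    step V ih sorted 2≤ [] _ _ = bound-empty sorted 2≤
    step V ih sorted 2≤ (P ∷ rest) disjoint within with any? (λ u → ¬? (u ∈? verts P)) V
    ... | no none-missing = bound-whole sorted P rest disjoint within
      (λ {u} u∈ → decidable-stable (u ∈? verts P) (none-missing ∘ lose u∈))
    ... | yes some-missing with find some-missing
    ...   | u , u∈V , u∉P = bound-chord ih sorted P rest disjoint within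
      (separating-chord (verts P) (verts-increasing P) (atLeast3 P) (within (here refl)) u∈V u∉P)

-- The descents of w

module Word {m : ℕ} (w : Permutation′ (suc m)) where

  rank : Fin (suc m) → ℕ
  rank v = toℕ (pos w v)

  rank-injective : ∀ {a b} → rank a ≡ rank b → a ≡ b
  rank-injective {a} {b} eq =
    trans (sym (inverseʳ w)) (trans (cong (w ⟨$⟩ʳ_) (toℕ-injective eq)) (inverseʳ w))

  open Descents rank rank-injective public

  word-increasing : AllPairs (λ a b → rank a < rank b) (tabulate (w ⟨$⟩ʳ_))
  word-increasing = tabulate⁺-< (subst₂ (λ p q → toℕ p < toℕ q) (sym (inverseˡ w)) (sym (inverseˡ w)))

  Cw⇒Clockwise : ∀ {a b c} → Cw w a b c → Clockwise a b c
  Cw⇒Clockwise (inj₁ abc) with AllPairs-resp-⊆ abc word-increasing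
  ... | (a<b ∷ _) ∷ (b<c ∷ []) ∷ [] ∷ [] = inj₁ (a<b , b<c)
  Cw⇒Clockwise (inj₂ (inj₁ bca)) with AllPairs-resp-⊆ bca word-increasing
  ... | (b<c ∷ _) ∷ (c<a ∷ []) ∷ [] ∷ [] = inj₂ (inj₁ (b<c , c<a))
  Cw⇒Clockwise (inj₂ (inj₂ cab)) with AllPairs-resp-⊆ cab word-increasing
  ... | (c<a ∷ _) ∷ (a<b ∷ []) ∷ [] ∷ [] = inj₂ (inj₂ (c<a , a<b))

  oriented-≡ : ∀ {P : Cell (suc m)} {t} → black P ≡ t → oriented P ≡ (if t then reverse (verts P) else verts P)
  oriented-≡ {P} = cong (if_then reverse (verts P) else verts P)

  cell-descents : ∀ {σ} → Cσ σ ⊆³ Cw w → ∀ {P} → P ∈ cells σ →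
    cyclicDescents (verts P) ≡ suc (blackTriangles P)
  cell-descents {σ} Cσ⊆Cw {P} P∈ with black P in colour
  ... | false = cyclicDescents-clockwise (verts P) (atLeast3 P) λ {a} {b} {c} abc →
    Cw⇒Clockwise (Cσ⊆Cw a b c (P , P∈ , inj₁ (subst ((a ∷ b ∷ c ∷ []) ⊆_) (sym (oriented-≡ {P = P} colour))
      abc)))
  ... | true = cyclicDescents-anticlockwise (verts P) (atLeast3 P) λ {a} {b} {c} abc →
    Cw⇒Clockwise (Cσ⊆Cw c b a (P , P∈ , inj₁ (subst ((c ∷ b ∷ a ∷ []) ⊆_) (sym (oriented-≡ {P = P} colour))
      (reverse⁺ abc))))

  successor : Fin (suc m) → Fin (suc m)
  successor = following id zero

  isDescentAt : Fin (suc m) → Bool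
  isDescentAt i = does (rank (successor i) ℕ.<? rank i)

  descentSet : Subset (suc m)
  descentSet = Vec.tabulate isDescentAt

  ∣descentSet∣ : Sub.∣ descentSet ∣ ≡ cyclicDescents (allFin (suc m))
  ∣descentSet∣ = trans (count-tabulate isDescentAt) (sym (descents-tabulate id zero))

  ∈descentSet⁺ : ∀ {i} → rank (successor i) < rank i → i Sub.∈ descentSet
  ∈descentSet⁺ {i} descent =
    lookup⇒[]= i descentSet (trans (lookup∘tabulate isDescentAt i) (dec-true (_ ℕ.<? _) descent))

  ∈descentSet⁻ : ∀ {i} → i Sub.∈ descentSet → rank (successor i) < rank i
  ∈descentSet⁻ {i} i∈ = decidable-stable (_ ℕ.<? _) λ ¬descent →
    contradiction (trans (sym (dec-false (_ ℕ.<? _) ¬descent))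
                         (trans (sym (lookup∘tabulate isDescentAt i)) ([]=⇒lookup i∈))) λ ()

  IsCycDescent⇒ : ∀ i → IsCycDescent w i → rank (successor i) < rank i
  IsCycDescent⇒ i descent with following-spec id zero i | descent
  ... | inj₁ (j , j≡ , s≡j) | inj₁ (j′ , j′≡ , j′<i) =
    subst (λ v → rank v < rank i) (trans (toℕ-injective (trans j′≡ (sym j≡))) (sym s≡j)) j′<i
  ... | inj₁ (j , j≡ , _) | inj₂ (last , _) = ⊥-elim (<-irrefl (trans j≡ last) (toℕ<n j))
  ... | inj₂ (last , _) | inj₁ (j′ , j′≡ , _) = ⊥-elim (<-irrefl (trans j′≡ (cong suc last)) (toℕ<n j′))
  ... | inj₂ (_ , s≡0) | inj₂ (_ , z , z≡0 , z<i) =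
    subst (λ v → rank v < rank i) (trans (toℕ-injective z≡0) (sym s≡0)) z<i

  IsCycDescent⇐ : ∀ i → rank (successor i) < rank i → IsCycDescent w i
  IsCycDescent⇐ i descent with following-spec id zero i
  ... | inj₁ (j , j≡ , s≡j) = inj₁ (j , j≡ , subst (λ v → rank v < rank i) s≡j descent)
  ... | inj₂ (last , s≡0) = inj₂ (cong suc last , zero , refl , subst (λ v → rank v < rank i) s≡0 descent)

lemma4p7 : (n k : ℕ) → 3 ≤ n → (σ : BicoloredSubdivision n) → HasType σ k →
    (w : Permutation′ n) → InD w → Cσ σ ⊆³ Cw w → InDk (suc k) w
lemma4p7 zero k () σ type w inD Cσ⊆Cw
lemma4p7 (suc m) k 3≤n σ type w inD Cσ⊆Cw =
  inD , descentSet , card , λ i → IsCycDescent⇐ i ∘ ∈descentSet⁻ , ∈descentSet⁺ ∘ IsCycDescent⇒ i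
  where
  open Word w
  open Dissection cyclicDescents (cyclicDescents-pair ∘ Finₚ.<⇒≢)
                                 (λ xs a ys b zs → cyclicDescents-cut xs a ys b zs ∘ Finₚ.<⇒≢)
  V : List (Fin (suc m))
  V = allFin (suc m)
  filled : triangleCount (cells σ) + 2 ≡ length V
  filled = trans (cong (_+ 2) (covers σ)) (trans (m∸n+n≡m (≤-trans (n≤1+n 2) 3≤n)) (sym (length-tabulate id)))
  weights : weight (cells σ) ≡ length (cells σ) + k
  weights = trans (sum-map-suc (cyclicDescents ∘ verts) blackTriangles (cells σ) (cell-descents {σ = σ} Cσ⊆Cw))
                  (cong (length (cells σ) +_) type)
  bound : DissectionBound (cells σ) V
  bound = dissection-bound V (tabulate⁺-< id) (subst (2 ≤_) (sym (length-tabulate id)) (≤-trans (n≤1+n 2) 3≤n))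
            (cells σ) (AllPairs.map proj₁ (disjoint σ)) (λ _ {z} _ → ∈-allFin z)
  count : (length (cells σ) + k) + 1 ≡ cyclicDescents V + length (cells σ)
  count = trans (cong (_+ 1) (sym weights)) (FillingBound.tight bound filled)
  card : Sub.∣ descentSet ∣ ≡ suc k
  card = trans ∣descentSet∣ (sym (+-cancelʳ-≡ (length (cells σ)) _ _ (trans (reorder (length (cells σ)) k) count)))
    where
    reorder : ∀ l k → suc k + l ≡ (l + k) + 1
    reorder = solve-∀
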